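{- Let $k$ and $N$ be positive integers and let $Y$ be a positive real number. Let $I_k(N,Y)$ denote the number of integer quadruples $(n_1,n_2,u_1,u_2)$ with $$1\leqslant n_1,n_2\leqslant N,\quad 1\leqslant u_1\leqslant n_1^k,\quad 1\leqslant u_2\leqslant n_2^k,$$ satisfying $$\left|\frac{u_1}{n_1^k}-\frac{u_2}{n_2^k}\right|\leqslant \frac{1}{Y}.$$ Then $$I_k(N,Y)\ll \left(\frac{N^{2k+2}}{Y}+N^{k+1}\right)N^{o(1)}.$$
   Context: The notation $A\ll B$ means $|A|\leqslant cB$ for a constant $c$ (which may depend on $k$); $N^{o(1)}$ denotes a factor $N^{\delta(N)}$ with $\delta(N)\to 0$ as $N\to\infty$ (depending on $k$ only), uniformly in $Y$.
   Formalization: The parameter Y ranges over the positive rationals instead of the positive reals. -}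

module Defs where

open import Data.Nat as ℕ using (ℕ; zero; suc; _^_)
open import Data.Nat.Properties using (m^n≢0)
open import Data.Integer using (+_)
open import Data.Rational using (ℚ; _/_; _-_; _*_; ∣_∣; _≤_; 1/_; Positive; 1ℚ)
open import Data.Rational.Properties using (_≤?_; pos⇒nonZero)
open import Data.List using (List; map; upTo)
open import Data.Nat.ListAction using (sum)
open import Data.Bool using (if_then_else_)
open import Relation.Nullary using (does)

-- the rational u / n^k (for n = 0 it is given the dummy value 0; never used)
frac : ℕ → ℕ → ℕ → ℚ
frac k u zero    = + 0 / 1
frac k u (suc m) = _/_ (+ u) (suc m ^ k) ⦃ m^n≢0 (suc m) k ⦄

inv : (Y : ℚ) → .⦃ _ : Positive Y ⦄ → ℚ
inv Y = (1/ Y) ⦃ pos⇒nonZero Y ⦄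

range1 : ℕ → List ℕ
range1 n = map suc (upTo n)

Σ[_]_ : List ℕ → (ℕ → ℕ) → ℕ
Σ[ xs ] f = sum (map f xs)

I : (k N : ℕ) (Y : ℚ) → .⦃ _ : Positive Y ⦄ → ℕ
I k N Y =
  Σ[ range1 N ] λ n₁ → Σ[ range1 N ] λ n₂ →
  Σ[ range1 (n₁ ^ k) ] λ u₁ → Σ[ range1 (n₂ ^ k) ] λ u₂ →
  (if does (∣ frac k u₁ n₁ - frac k u₂ n₂ ∣ ≤? inv Y) then 1 else 0)

_^ℚ_ : ℚ → ℕ → ℚ
q ^ℚ zero  = 1ℚ
q ^ℚ suc n = q * (q ^ℚ n)

fromℕ : ℕ → ℚ
fromℕ n = + n / 1

{-# OPTIONS --safe #-}
module Submission where

-- Fix n₁, n₂ ≤ N, put d = gcd(n₁,n₂), nᵢ = d xᵢ and Y = p/q. Clearing denominators, the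
-- condition on (u₁,u₂) reads |u₁x₂ᵏ − u₂x₁ᵏ| ≤ T₀ := q dᵏ(x₁x₂)ᵏ/p. Since x₁ᵏ and x₂ᵏ are
-- coprime, for each of the 2T₀+1 values of u₁x₂ᵏ − u₂x₁ᵏ the admissible u₁ ≤ n₁ᵏ are x₁ᵏ
-- apart, so there are at most dᵏ of them: the pair (n₁,n₂) contributes at most
-- 2(n₁n₂)ᵏ/Y + gcd(n₁,n₂)ᵏ. Bounding gcd(n₁,n₂) by the sum of the common divisors,
--   Σ gcd(n₁,n₂)ᵏ ≤ Nᵏ⁻¹ Σ_e e⌊N/e⌋² ≤ Nᵏ Σ_{e≤N} ⌊N/e⌋,
-- and cutting e ≤ N into the blocks [Rⁱ, Rⁱ⁺¹) with R = 2ᵇ, each block contributes at most RN.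
-- If Rʲ ≤ N ≤ Rʲ⁺¹ there are L = j + 2 blocks, and L ≤ 2ʲ⁺¹ gives Lᵇ ≤ Rʲ⁺¹ ≤ RN: the
-- logarithmic loss is absorbed into the constant R² and the factor Nᵃ.

open import Defs

module Counting where
  open import Data.Nat
  open import Data.Nat.Properties
  open import Data.Nat.DivMod using (_/_; _%_; m/n*n≤m; m*n/n≡m; /-monoˡ-≤; m≡m%n+[m/n]*n; m%n<n)
  open import Data.Nat.Divisibility using (_∣_; _∣?_; divides; ∣⇒≤; ∣m+n∣m⇒∣n; n∣m*n)
  open import Data.Nat.GCD using (gcd; gcd[m,n]∣m; gcd[m,n]∣n; gcd[m,n]≤n; gcd-comm; gcd[m,n]≢0)
  open import Data.Nat.Coprimality using (Coprime; coprime-divisor)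
  open import Data.Nat.Tactic.RingSolver using (solve-∀)
  open import Data.Product using (∃; _,_; _×_; proj₁; proj₂)
  open import Data.Bool using (if_then_else_)
  open import Data.Empty using (⊥-elim)
  open import Function using (_∘_)
  open import Relation.Nullary using (Dec; does; yes; no; ¬_)
  open import Data.Sum using (inj₁)
  open import Relation.Binary.PropositionalEquality
  import Algebra.Properties.CommutativeSemigroup +-commutativeSemigroup as +-CS

  ∑ : ℕ → (ℕ → ℕ) → ℕ
  ∑ zero    f = 0
  ∑ (suc n) f = f 0 + ∑ n (f ∘ suc)

  -- The summand extends over _+_ and _*_: ∑[ i < n ] f i * c is Σᵢ (f i * c).
  infix 5 ∑
  syntax ∑ n (λ i → e) = ∑[ i < n ] e

  ∑-cong : ∀ n {f g : ℕ → ℕ} → (∀ i → i < n → f i ≡ g i) → ∑ n f ≡ ∑ n g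
  ∑-cong zero    f≡g = refl
  ∑-cong (suc n) f≡g = cong₂ _+_ (f≡g 0 z<s) (∑-cong n (λ i i<n → f≡g (suc i) (s<s i<n)))

  ∑-mono-≤ : ∀ n {f g : ℕ → ℕ} → (∀ i → i < n → f i ≤ g i) → ∑ n f ≤ ∑ n g
  ∑-mono-≤ zero    f≤g = z≤n
  ∑-mono-≤ (suc n) f≤g = +-mono-≤ (f≤g 0 z<s) (∑-mono-≤ n (λ i i<n → f≤g (suc i) (s<s i<n)))

  ∑-const : ∀ n c → ∑[ _ < n ] c ≡ n * c
  ∑-const zero    c = refl
  ∑-const (suc n) c = cong (c +_) (∑-const n c)

  ∑-vanishes : ∀ n {f : ℕ → ℕ} → (∀ i → i < n → f i ≡ 0) → ∑ n f ≡ 0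
  ∑-vanishes n f≡0 = trans (∑-cong n f≡0) (trans (∑-const n 0) (*-zeroʳ n))

  ∑-distrib-+ : ∀ n (f g : ℕ → ℕ) → ∑[ i < n ] (f i + g i) ≡ ∑ n f + ∑ n g
  ∑-distrib-+ zero    f g = refl
  ∑-distrib-+ (suc n) f g = trans (cong (f 0 + g 0 +_) (∑-distrib-+ n (f ∘ suc) (g ∘ suc)))
                                  (+-CS.interchange (f 0) (g 0) _ _)

  ∑-distribˡ-* : ∀ n c (f : ℕ → ℕ) → ∑[ i < n ] (c * f i) ≡ c * ∑ n f
  ∑-distribˡ-* zero    c f = sym (*-zeroʳ c)
  ∑-distribˡ-* (suc n) c f =
    trans (cong (c * f 0 +_) (∑-distribˡ-* n c (f ∘ suc))) (sym (*-distribˡ-+ c (f 0) _))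

  ∑-distribʳ-* : ∀ n c (f : ℕ → ℕ) → ∑[ i < n ] (f i * c) ≡ ∑ n f * c
  ∑-distribʳ-* n c f =
    trans (∑-cong n (λ i _ → *-comm (f i) c)) (trans (∑-distribˡ-* n c f) (*-comm c (∑ n f)))

  ∑-comm : ∀ m n (f : ℕ → ℕ → ℕ) → ∑[ i < m ] ∑[ j < n ] f i j ≡ ∑[ j < n ] ∑[ i < m ] f i j
  ∑-comm zero    n f = sym (∑-vanishes n (λ _ _ → refl))
  ∑-comm (suc m) n f = trans (cong (∑ n (f 0) +_) (∑-comm m n (f ∘ suc)))
                             (sym (∑-distrib-+ n (f 0) (λ j → ∑[ i < m ] f (suc i) j)))

  ∑-split : ∀ m n (f : ℕ → ℕ) → ∑ (m + n) f ≡ ∑ m f + (∑[ j < n ] f (m + j))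
  ∑-split zero    n f = refl
  ∑-split (suc m) n f = trans (cong (f 0 +_) (∑-split m n (f ∘ suc))) (sym (+-assoc (f 0) _ _))

  term≤∑ : ∀ n (f : ℕ → ℕ) {i} → i < n → f i ≤ ∑ n f
  term≤∑ (suc n) f {zero}  _         = m≤m+n (f 0) _
  term≤∑ (suc n) f {suc i} (s<s i<n) = ≤-trans (term≤∑ n (f ∘ suc) i<n) (m≤n+m _ (f 0))

  ∑-positive : ∀ n (f : ℕ → ℕ) → 1 ≤ ∑ n f → ∃ λ i → i < n × 1 ≤ f i
  ∑-positive (suc n) f 1≤∑ with f 0 in eq
  ... | suc _ = 0 , z<s , subst (1 ≤_) (sym eq) (s≤s z≤n)
  ... | zero with ∑-positive n (f ∘ suc) 1≤∑
  ...   | i , i<n , 1≤fi = suc i , s<s i<n , 1≤fi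

  𝟙 : {P : Set} → Dec P → ℕ
  𝟙 d = if does d then 1 else 0

  𝟙≤1 : {P : Set} (d : Dec P) → 𝟙 d ≤ 1
  𝟙≤1 (yes _) = ≤-refl
  𝟙≤1 (no _)  = z≤n

  𝟙-sound : {P : Set} (d : Dec P) → 1 ≤ 𝟙 d → P
  𝟙-sound (yes p) _ = p

  𝟙-complete : {P : Set} (d : Dec P) → P → 𝟙 d ≡ 1
  𝟙-complete (yes _) _ = refl
  𝟙-complete (no ¬p) p = ⊥-elim (¬p p)

  𝟙-reject : {P : Set} (d : Dec P) → ¬ P → 𝟙 d ≡ 0
  𝟙-reject (yes p) ¬p = ⊥-elim (¬p p)
  𝟙-reject (no _)  _  = refl

  ≤1-positive⇒≤ : ∀ {x y} → x ≤ 1 → (1 ≤ x → 1 ≤ y) → x ≤ y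
  ≤1-positive⇒≤ z≤n       _      = z≤n
  ≤1-positive⇒≤ (s≤s z≤n) 1≤x⇒1≤y = 1≤x⇒1≤y (s≤s z≤n)

  Separated : ℕ → (ℕ → ℕ) → Set
  Separated d f = ∀ {i j} → i < j → 1 ≤ f i → 1 ≤ f j → i + d ≤ j

  separated-shift : ∀ {d} m {f : ℕ → ℕ} → Separated d f → Separated d (λ j → f (m + j))
  separated-shift {d} m {f} sep {i} {j} i<j fi fj =
    +-cancelˡ-≤ m (i + d) j (subst (_≤ m + j) (+-assoc m i d) (sep (+-monoʳ-< m i<j) fi fj))

  ∑≤1 : ∀ n (f : ℕ → ℕ) → (∀ i → f i ≤ 1) → Separated n f → ∑ n f ≤ 1
  ∑≤1 zero    f f≤1 sep = z≤n
  ∑≤1 (suc n) f f≤1 sep with f 0 in eq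
  ... | zero  = ∑≤1 n (f ∘ suc) (f≤1 ∘ suc) (λ {i} i<j fi fj →
                  ≤-trans (+-monoʳ-≤ i (n≤1+n n)) (≤-pred (sep (s<s i<j) fi fj)))
  ... | suc m = begin
        suc m + ∑ n (f ∘ suc) ≡⟨ cong (suc m +_) (∑-vanishes n rest-zero) ⟩
        suc m + 0             ≡⟨ trans (+-identityʳ (suc m)) (sym eq) ⟩
        f 0                   ≤⟨ f≤1 0 ⟩
        1                     ∎
    where
    open ≤-Reasoning
    rest-zero : ∀ i → i < n → f (suc i) ≡ 0
    rest-zero i i<n with f (suc i) in eq′
    ... | zero  = refl
    ... | suc _ = ⊥-elim (<-irrefl refl (<-≤-trans (s<s i<n)
                    (sep z<s (subst (1 ≤_) (sym eq) (s≤s z≤n)) (subst (1 ≤_) (sym eq′) (s≤s z≤n)))))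

  ∑-separated : ∀ q d (f : ℕ → ℕ) → (∀ i → f i ≤ 1) → Separated d f → ∑ (q * d) f ≤ q
  ∑-separated zero    d f f≤1 sep = z≤n
  ∑-separated (suc q) d f f≤1 sep = begin
    ∑ (d + q * d) f                           ≡⟨ ∑-split d (q * d) f ⟩
    ∑ d f + (∑[ j < q * d ] f (d + j))        ≤⟨ +-mono-≤ (∑≤1 d f f≤1 sep)
                                                   (∑-separated q d _ (λ j → f≤1 (d + j)) (separated-shift d sep)) ⟩
    1 + q                                     ∎
    where open ≤-Reasoning

  coprime-solutions-separated : ∀ {A B} .{{_ : NonZero A}} → Coprime A B →
    ∀ {z T₀ u u′ v v′} → z + v * A ≡ u * B + T₀ → z + v′ * A ≡ u′ * B + T₀ → u < u′ → u + A ≤ u′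
  coprime-solutions-separated {A} {B} A⊥B {z} {T₀} {u} {u′} {v} {v′} e e′ u<u′ = begin
    u + A ≤⟨ +-monoʳ-≤ u (∣⇒≤ ⦃ >-nonZero (m<n⇒0<n∸m u<u′) ⦄ A∣δ) ⟩
    u + δ ≡⟨ m+[n∸m]≡n (<⇒≤ u<u′) ⟩
    u′    ∎
    where
    open ≤-Reasoning
    δ = u′ ∸ u
    shift : ∀ u δ B T₀ → (u + δ) * B + T₀ ≡ (u * B + T₀) + δ * B
    shift = solve-∀
    v′A≡ : v′ * A ≡ v * A + δ * B
    v′A≡ = +-cancelˡ-≡ z _ _ (begin-equality
      z + v′ * A           ≡⟨ e′ ⟩
      u′ * B + T₀          ≡⟨ cong (λ w → w * B + T₀) (sym (m+[n∸m]≡n (<⇒≤ u<u′))) ⟩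
      (u + δ) * B + T₀     ≡⟨ shift u δ B T₀ ⟩
      u * B + T₀ + δ * B   ≡⟨ cong (_+ δ * B) (sym e) ⟩
      z + v * A + δ * B    ≡⟨ +-assoc z (v * A) (δ * B) ⟩
      z + (v * A + δ * B)  ∎)
    A∣δ : A ∣ δ
    A∣δ = coprime-divisor A⊥B (divides (v′ ∸ v) (begin-equality
      B * δ                    ≡⟨ *-comm B δ ⟩
      δ * B                    ≡⟨ sym (m+n∸m≡n (v * A) (δ * B)) ⟩
      v * A + δ * B ∸ v * A    ≡⟨ cong (_∸ v * A) (sym v′A≡) ⟩
      v′ * A ∸ v * A           ≡⟨ sym (*-distribʳ-∸ A v′ v) ⟩
      (v′ ∸ v) * A             ∎))

  -- A pair (i, j) of the band has offset z = (i+1)B + T₀ − (j+1)A < Z; for a fixed z the rows i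
  -- admitting a solution j lie A apart (coprimality), so each z accounts for at most g rows.
  module BandCount {A B : ℕ} .{{_ : NonZero A}} (A⊥B : Coprime A B) (g T₀ : ℕ) where

    hit : ℕ → ℕ → ℕ → ℕ
    hit z i j = 𝟙 (z + suc j * A ≟ suc i * B + T₀)

    hit-sound : ∀ z i j → 1 ≤ hit z i j → z + suc j * A ≡ suc i * B + T₀
    hit-sound z i j = 𝟙-sound (z + suc j * A ≟ suc i * B + T₀)

    solutions : ℕ → ℕ → ℕ
    solutions z i = ∑ (g * B) (hit z i)

    solutions≤1 : ∀ z i → solutions z i ≤ 1
    solutions≤1 z i = ∑≤1 (g * B) (hit z i) (λ j → 𝟙≤1 (z + suc j * A ≟ suc i * B + T₀))
      (λ {j} {j′} j<j′ p p′ → ⊥-elim (<-irrefl (suc-injective (*-cancelʳ-≡ (suc j) (suc j′) A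
        (+-cancelˡ-≡ z _ _ (trans (hit-sound z i j p) (sym (hit-sound z i j′ p′)))))) j<j′))

    solvable : ∀ z i → 1 ≤ solutions z i → ∃ λ j → z + suc j * A ≡ suc i * B + T₀
    solvable z i p with ∑-positive (g * B) (hit z i) p
    ... | j , _ , q = j , hit-sound z i j q

    solutions-separated : ∀ z → Separated A (solutions z)
    solutions-separated z {i} {i′} i<i′ p p′
      with j , e ← solvable z i p | j′ , e′ ← solvable z i′ p′ =
      ≤-pred (coprime-solutions-separated A⊥B {z} {v = suc j} {suc j′} e e′ (s<s i<i′))

    count : ∀ Z (P : ℕ → ℕ → ℕ) →
      (∀ i j → i < g * A → j < g * B →
         P i j ≤ 1 × (1 ≤ P i j → ∃ λ z → z < Z × z + suc j * A ≡ suc i * B + T₀)) →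
      ∑[ i < g * A ] ∑[ j < g * B ] P i j ≤ Z * g
    count Z P hP = begin
      ∑[ i < g * A ] ∑[ j < g * B ] P i j
        ≤⟨ ∑-mono-≤ (g * A) (λ i i< → ∑-mono-≤ (g * B) (λ j j< → P≤hits i j i< j<)) ⟩
      ∑[ i < g * A ] ∑[ j < g * B ] ∑[ z < Z ] hit z i j
        ≡⟨ ∑-cong (g * A) (λ i _ → ∑-comm (g * B) Z (λ j z → hit z i j)) ⟩
      ∑[ i < g * A ] ∑[ z < Z ] solutions z i
        ≡⟨ ∑-comm (g * A) Z (λ i z → solutions z i) ⟩
      ∑[ z < Z ] ∑[ i < g * A ] solutions z i
        ≤⟨ ∑-mono-≤ Z (λ z _ → ∑-separated g A (solutions z) (solutions≤1 z) (solutions-separated z)) ⟩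
      ∑[ _ < Z ] g
        ≡⟨ ∑-const Z g ⟩
      Z * g ∎
      where
      open ≤-Reasoning
      P≤hits : ∀ i j → i < g * A → j < g * B → P i j ≤ ∑[ z < Z ] hit z i j
      P≤hits i j i< j< = ≤1-positive⇒≤ (proj₁ (hP i j i< j<)) λ P-pos →
        let z , z<Z , e = proj₂ (hP i j i< j<) P-pos
        in ≤-trans (≤-reflexive (sym (𝟙-complete (z + suc j * A ≟ suc i * B + T₀) e)))
                   (term≤∑ Z (λ z → hit z i j) z<Z)

  band-offset : ∀ {X W T₀} → ∣ X - W ∣ ≤ T₀ → ∃ λ z → z < suc (T₀ + T₀) × z + W ≡ X + T₀
  band-offset {X} {W} {T₀} ∣X-W∣≤T₀ = X + T₀ ∸ W , s≤s z≤2T₀ , m∸n+n≡m W≤X+T₀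
    where
    open ≤-Reasoning
    W≤X+T₀ : W ≤ X + T₀
    W≤X+T₀ = ≤-trans (m≤n+m∸n W X)
      (+-monoʳ-≤ X (≤-trans (subst (W ∸ X ≤_) (∣-∣-comm W X) (m∸n≤∣m-n∣ W X)) ∣X-W∣≤T₀))
    z≤2T₀ : X + T₀ ∸ W ≤ T₀ + T₀
    z≤2T₀ = begin
      X + T₀ ∸ W       ≤⟨ ∸-monoˡ-≤ W (+-monoˡ-≤ T₀ (≤-trans (m≤n+m∸n X W)
                            (+-monoʳ-≤ W (≤-trans (m∸n≤∣m-n∣ X W) ∣X-W∣≤T₀)))) ⟩
      W + T₀ + T₀ ∸ W  ≡⟨ cong (_∸ W) (+-assoc W T₀ T₀) ⟩
      W + (T₀ + T₀) ∸ W ≡⟨ m+n∸m≡n W (T₀ + T₀) ⟩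
      T₀ + T₀          ∎

  band-count : ∀ g A B p q .{{_ : NonZero g}} .{{_ : NonZero A}} .{{_ : NonZero p}} → Coprime A B →
    (P : ℕ → ℕ → ℕ) →
    (∀ i j → i < g * A → j < g * B → P i j ≤ 1 ×
       (1 ≤ P i j → ∣ suc i * (g * B) - suc j * (g * A) ∣ * p ≤ q * ((g * A) * (g * B)))) →
    (∑[ i < g * A ] ∑[ j < g * B ] P i j) * p ≤ 2 * (q * ((g * A) * (g * B))) + g * p
  band-count g A B p q A⊥B P hP = begin
    (∑[ i < g * A ] ∑[ j < g * B ] P i j) * p
      ≤⟨ *-monoˡ-≤ p (BandCount.count A⊥B g T₀ (suc (T₀ + T₀)) P (λ i j i< j< →
           proj₁ (hP i j i< j<) , λ P-pos → band-offset (within-band i j (proj₂ (hP i j i< j<) P-pos)))) ⟩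
    suc (T₀ + T₀) * g * p          ≡⟨ regroup T₀ g p ⟩
    g * p + 2 * (g * (T₀ * p))     ≤⟨ +-monoʳ-≤ (g * p) (*-monoʳ-≤ 2 (*-monoʳ-≤ g (m/n*n≤m T p))) ⟩
    g * p + 2 * (g * T)            ≡⟨ unfold-T g p q A B ⟩
    2 * (q * ((g * A) * (g * B))) + g * p ∎
    where
    open ≤-Reasoning
    T = q * A * B * g
    T₀ = T / p
    regroup : ∀ T₀ g p → suc (T₀ + T₀) * g * p ≡ g * p + 2 * (g * (T₀ * p))
    regroup = solve-∀
    unfold-T : ∀ g p q A B → g * p + 2 * (g * (q * A * B * g)) ≡ 2 * (q * ((g * A) * (g * B))) + g * p
    unfold-T = solve-∀
    pull-g : ∀ g u C → g * (u * C) ≡ u * (g * C)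
    pull-g = solve-∀
    pull-gT : ∀ q g A B → q * ((g * A) * (g * B)) ≡ g * (q * A * B * g)
    pull-gT = solve-∀
    within-band : ∀ i j → ∣ suc i * (g * B) - suc j * (g * A) ∣ * p ≤ q * ((g * A) * (g * B)) →
      ∣ suc i * B - suc j * A ∣ ≤ T₀
    within-band i j H = subst (_≤ T₀) (m*n/n≡m ∣ X - W ∣ p) (/-monoˡ-≤ p (*-cancelˡ-≤ g (begin
      g * (∣ X - W ∣ * p)                        ≡⟨ sym (*-assoc g _ p) ⟩
      g * ∣ X - W ∣ * p                          ≡⟨ cong (_* p) (*-distribˡ-∣-∣ g X W) ⟩
      ∣ g * X - g * W ∣ * p                      ≡⟨ cong₂ (λ a b → ∣ a - b ∣ * p) (pull-g g (suc i) B) (pull-g g (suc j) A) ⟩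
      ∣ suc i * (g * B) - suc j * (g * A) ∣ * p  ≤⟨ H ⟩
      q * ((g * A) * (g * B))                    ≡⟨ pull-gT q g A B ⟩
      g * T                                      ∎)))
      where
      X = suc i * B
      W = suc j * A

  multiples : ℕ → ℕ → ℕ
  multiples d N = ∑[ a < N ] 𝟙 (d ∣? suc a)

  multiples-separated : ∀ d .{{_ : NonZero d}} → Separated d (λ a → 𝟙 (d ∣? suc a))
  multiples-separated d {a} {a′} a<a′ p p′ = begin
    a + d         ≤⟨ +-monoʳ-≤ a (∣⇒≤ ⦃ >-nonZero (m<n⇒0<n∸m a<a′) ⦄ d∣a′∸a) ⟩
    a + (a′ ∸ a)  ≡⟨ a+[a′∸a]≡a′ ⟩
    a′            ∎
    where
    open ≤-Reasoning
    a+[a′∸a]≡a′ = m+[n∸m]≡n (<⇒≤ a<a′)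
    d∣a′∸a : d ∣ a′ ∸ a
    d∣a′∸a = ∣m+n∣m⇒∣n (subst (d ∣_) (cong suc (sym a+[a′∸a]≡a′)) (𝟙-sound (d ∣? suc a′) p′))
                        (𝟙-sound (d ∣? suc a) p)

  *-multiples≤ : ∀ d .{{_ : NonZero d}} N → d * multiples d N ≤ N
  *-multiples≤ d N = begin
    d * multiples d N                        ≡⟨ cong (λ M → d * multiples d M) N≡td+r ⟩
    d * multiples d (t * d + r)              ≡⟨ cong (d *_) (∑-split (t * d) r f) ⟩
    d * (∑ (t * d) f + (∑[ j < r ] f (t * d + j)))
                                             ≡⟨ cong (λ x → d * (∑ (t * d) f + x)) (∑-vanishes r tail-zero) ⟩
    d * (∑ (t * d) f + 0)                    ≤⟨ *-monoʳ-≤ d (+-monoˡ-≤ 0 (∑-separated t d f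
                                                  (λ a → 𝟙≤1 (d ∣? suc a)) (multiples-separated d))) ⟩
    d * (t + 0)                              ≡⟨ trans (cong (d *_) (+-identityʳ t)) (*-comm d t) ⟩
    t * d                                    ≤⟨ m≤m+n (t * d) r ⟩
    t * d + r                                ≡⟨ sym N≡td+r ⟩
    N                                        ∎
    where
    open ≤-Reasoning
    f = λ a → 𝟙 (d ∣? suc a)
    t = N / d
    r = N % d
    N≡td+r : N ≡ t * d + r
    N≡td+r = trans (m≡m%n+[m/n]*n N d) (+-comm r (t * d))
    tail-zero : ∀ j → j < r → f (t * d + j) ≡ 0
    tail-zero j j<r = 𝟙-reject (d ∣? suc (t * d + j)) (λ d∣ → <-irrefl refl (<-≤-trans
      (≤-<-trans j<r (m%n<n N d)) (∣⇒≤ (∣m+n∣m⇒∣n (subst (d ∣_) (sym (+-suc (t * d) j)) d∣) (n∣m*n t)))))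

  divisor-sum : ℕ → ℕ
  divisor-sum N = ∑[ e < N ] multiples (suc e) N

  divides-both : ℕ → ℕ → ℕ → ℕ
  divides-both e a b = 𝟙 (suc e ∣? suc a) * 𝟙 (suc e ∣? suc b)

  gcd≤∑common-divisors : ∀ N a b → a < N → gcd (suc a) (suc b) ≤ ∑[ e < N ] suc e * divides-both e a b
  gcd≤∑common-divisors N a b a<N = subst (_≤ ∑[ e < N ] suc e * divides-both e a b) term≡G
      (term≤∑ N (λ e → suc e * divides-both e a b) e<N)
    where
    G = gcd (suc a) (suc b)
    e = pred G
    1+e≡G : suc e ≡ G
    1+e≡G = suc-pred G ⦃ ≢-nonZero (gcd[m,n]≢0 (suc a) (suc b) (inj₁ (λ ()))) ⦄
    e<N : e < N
    e<N = <-≤-trans (≤-reflexive 1+e≡G)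
      (≤-trans (subst (_≤ suc a) (gcd-comm (suc b) (suc a)) (gcd[m,n]≤n (suc b) (suc a))) a<N)
    term≡G : suc e * divides-both e a b ≡ G
    term≡G = begin
      suc e * divides-both e a b
        ≡⟨ cong₂ (λ x y → suc e * (x * y))
             (𝟙-complete (suc e ∣? suc a) (subst (_∣ suc a) (sym 1+e≡G) (gcd[m,n]∣m (suc a) (suc b))))
             (𝟙-complete (suc e ∣? suc b) (subst (_∣ suc b) (sym 1+e≡G) (gcd[m,n]∣n (suc a) (suc b)))) ⟩
      suc e * 1        ≡⟨ *-identityʳ (suc e) ⟩
      suc e            ≡⟨ 1+e≡G ⟩
      G                ∎
      where open ≡-Reasoning

  ∑∑gcd≤ : ∀ N → ∑[ a < N ] ∑[ b < N ] gcd (suc a) (suc b) ≤ N * divisor-sum N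
  ∑∑gcd≤ N = begin
    ∑[ a < N ] ∑[ b < N ] gcd (suc a) (suc b)
      ≤⟨ ∑-mono-≤ N (λ a a<N → ∑-mono-≤ N (λ b _ → gcd≤∑common-divisors N a b a<N)) ⟩
    ∑[ a < N ] ∑[ b < N ] ∑[ e < N ] suc e * divides-both e a b
      ≡⟨ ∑-cong N (λ a _ → ∑-comm N N (λ b e → suc e * divides-both e a b)) ⟩
    ∑[ a < N ] ∑[ e < N ] ∑[ b < N ] suc e * divides-both e a b
      ≡⟨ ∑-comm N N (λ a e → ∑[ b < N ] suc e * divides-both e a b) ⟩
    ∑[ e < N ] ∑[ a < N ] ∑[ b < N ] suc e * divides-both e a b
      ≡⟨ ∑-cong N (λ e _ → factorise e) ⟩
    ∑[ e < N ] (suc e * multiples (suc e) N) * multiples (suc e) N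
      ≤⟨ ∑-mono-≤ N (λ e _ → *-monoˡ-≤ (multiples (suc e) N) (*-multiples≤ (suc e) N)) ⟩
    ∑[ e < N ] N * multiples (suc e) N
      ≡⟨ ∑-distribˡ-* N N (λ e → multiples (suc e) N) ⟩
    N * divisor-sum N ∎
    where
    open ≤-Reasoning
    factorise : ∀ e → ∑[ a < N ] ∑[ b < N ] suc e * divides-both e a b
                      ≡ (suc e * multiples (suc e) N) * multiples (suc e) N
    factorise e = begin-equality
      ∑[ a < N ] ∑[ b < N ] suc e * (δ a * δ b)
        ≡⟨ ∑-cong N (λ a _ → trans (∑-cong N (λ b _ → sym (*-assoc (suc e) (δ a) (δ b))))
                                   (∑-distribˡ-* N (suc e * δ a) δ)) ⟩
      ∑[ a < N ] (suc e * δ a) * multiples (suc e) N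
        ≡⟨ ∑-distribʳ-* N (multiples (suc e) N) (λ a → suc e * δ a) ⟩
      (∑[ a < N ] suc e * δ a) * multiples (suc e) N
        ≡⟨ cong (_* multiples (suc e) N) (∑-distribˡ-* N (suc e) δ) ⟩
      (suc e * multiples (suc e) N) * multiples (suc e) N ∎
      where
      δ = λ a → 𝟙 (suc e ∣? suc a)

  ∑-dyadic : ∀ R N (f : ℕ → ℕ) .{{_ : NonZero R}} → (∀ e → suc e * f e ≤ N) →
    ∀ M → ∑ (R ^ M) f ≤ suc M * (R * N)
  ∑-dyadic R N f ef≤N zero = begin
    f 0 + 0      ≡⟨ trans (+-identityʳ (f 0)) (sym (*-identityˡ (f 0))) ⟩
    1 * f 0      ≤⟨ ef≤N 0 ⟩
    N            ≤⟨ m≤n*m N R ⟩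
    R * N        ≡⟨ sym (+-identityʳ (R * N)) ⟩
    1 * (R * N)  ∎
    where open ≤-Reasoning
  ∑-dyadic R N f ef≤N (suc M) = begin
    ∑ (R * P) f                                 ≡⟨ cong (λ x → ∑ x f) (sym (m+[n∸m]≡n P≤RP)) ⟩
    ∑ (P + (R * P ∸ P)) f                       ≡⟨ ∑-split P (R * P ∸ P) f ⟩
    ∑ P f + (∑[ t < R * P ∸ P ] f (P + t))      ≤⟨ +-mono-≤ (∑-dyadic R N f ef≤N M) block ⟩
    suc M * (R * N) + R * N                     ≡⟨ +-comm (suc M * (R * N)) (R * N) ⟩
    suc (suc M) * (R * N)                       ∎
    where
    open ≤-Reasoning
    P = R ^ M
    instance
      P≢0 : NonZero P
      P≢0 = m^n≢0 R M
    P≤RP : P ≤ R * P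
    P≤RP = m≤n*m P R
    block : ∑[ t < R * P ∸ P ] f (P + t) ≤ R * N
    block = *-cancelˡ-≤ P (begin
      P * (∑[ t < R * P ∸ P ] f (P + t))  ≡⟨ sym (∑-distribˡ-* (R * P ∸ P) P (λ t → f (P + t))) ⟩
      ∑[ t < R * P ∸ P ] P * f (P + t)    ≤⟨ ∑-mono-≤ (R * P ∸ P) (λ t _ →
                                                ≤-trans (*-monoˡ-≤ (f (P + t)) (m≤n⇒m≤1+n (m≤m+n P t)))
                                                        (ef≤N (P + t))) ⟩
      ∑[ _ < R * P ∸ P ] N                ≡⟨ ∑-const (R * P ∸ P) N ⟩
      (R * P ∸ P) * N                     ≤⟨ *-monoˡ-≤ N (m∸n≤m (R * P) P) ⟩
      R * P * N                           ≡⟨ cong (_* N) (*-comm R P) ⟩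
      P * R * N                           ≡⟨ *-assoc P R N ⟩
      P * (R * N)                         ∎)

  divisor-sum≤ : ∀ R N M .{{_ : NonZero R}} → N ≤ R ^ M → divisor-sum N ≤ suc M * (R * N)
  divisor-sum≤ R N M N≤R^M = begin
    divisor-sum N                                       ≤⟨ m≤m+n (divisor-sum N) _ ⟩
    divisor-sum N + (∑[ t < R ^ M ∸ N ] F (N + t))      ≡⟨ sym (∑-split N (R ^ M ∸ N) F) ⟩
    ∑ (N + (R ^ M ∸ N)) F                               ≡⟨ cong (λ x → ∑ x F) (m+[n∸m]≡n N≤R^M) ⟩
    ∑ (R ^ M) F                                         ≤⟨ ∑-dyadic R N F (λ e → *-multiples≤ (suc e) N) M ⟩
    suc M * (R * N)                                     ∎
    where
    open ≤-Reasoning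
    F = λ e → multiples (suc e) N

  between-powers : ∀ {R} → 1 < R → ∀ N .{{_ : NonZero N}} → ∃ λ j → R ^ j ≤ N × N ≤ R ^ suc j
  between-powers {R} 1<R (suc zero) = 0 , ≤-refl , m^n>0 R ⦃ >-nonZero (<-trans z<s 1<R) ⦄ 1
  between-powers {R} 1<R (suc (suc N)) with between-powers 1<R (suc N)
  ... | j , lo , hi with suc (suc N) ≤? R ^ suc j
  ...   | yes hi′ = j , m≤n⇒m≤1+n lo , hi′
  ...   | no ¬hi′ = suc j , ≤-trans (≤-reflexive (sym N+1≡x)) (n≤1+n (suc N)) , hi″
    where
    open ≤-Reasoning
    x = R ^ suc j
    N+1≡x : suc N ≡ x
    N+1≡x = ≤-antisym hi (≮⇒≥ ¬hi′)
    hi″ : suc (suc N) ≤ R * x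
    hi″ = begin
      suc (suc N)  ≡⟨ cong suc N+1≡x ⟩
      1 + x        ≤⟨ +-monoˡ-≤ x (≤-trans (s≤s z≤n) (≤-reflexive N+1≡x)) ⟩
      x + x        ≡⟨ cong (x +_) (sym (+-identityʳ x)) ⟩
      2 * x        ≤⟨ *-monoˡ-≤ x 1<R ⟩
      R * x        ∎

  1+n≤2^n : ∀ n → 1 + n ≤ 2 ^ n
  1+n≤2^n zero    = ≤-refl
  1+n≤2^n (suc n) = begin
    2 + n          ≤⟨ s≤s (1+n≤2^n n) ⟩
    1 + 2 ^ n      ≤⟨ +-monoˡ-≤ (2 ^ n) (m^n>0 2 n) ⟩
    2 ^ n + 2 ^ n  ≡⟨ cong (2 ^ n +_) (sym (+-identityʳ (2 ^ n))) ⟩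
    2 * 2 ^ n      ∎
    where open ≤-Reasoning

  1<2^n : ∀ n .{{_ : NonZero n}} → 1 < 2 ^ n
  1<2^n n@(suc _) = <-≤-trans (s<s (>-nonZero⁻¹ n)) (1+n≤2^n n)

  m≤m^n : ∀ m n .{{_ : NonZero m}} .{{_ : NonZero n}} → m ≤ m ^ n
  m≤m^n m (suc n) = m≤m*n m (m ^ n) ⦃ m^n≢0 m n ⦄

  log-factor : ∀ a b j N .{{_ : NonZero a}} .{{_ : NonZero b}} .{{_ : NonZero N}} →
    (2 ^ b) ^ j ≤ N → (2 + j) ^ b ≤ (2 ^ b) ^ b * N ^ a
  log-factor a b j N R^j≤N = begin
    (2 + j) ^ b             ≤⟨ ^-monoˡ-≤ b (1+n≤2^n (suc j)) ⟩
    (2 ^ suc j) ^ b         ≡⟨ trans (^-*-assoc 2 (suc j) b) (trans (cong (2 ^_) (*-comm (suc j) b))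
                                 (sym (^-*-assoc 2 b (suc j)))) ⟩
    R * R ^ j               ≤⟨ *-mono-≤ (m≤m^n R b) (≤-trans R^j≤N (m≤m^n N a)) ⟩
    R ^ b * N ^ a           ∎
    where
    open ≤-Reasoning
    R = 2 ^ b
    instance
      R≢0 : NonZero R
      R≢0 = m^n≢0 2 b

module Rationals where
  open import Data.Nat as ℕ using (ℕ; zero; suc; NonZero)
  import Data.Nat.Properties as ℕ
  open import Data.Integer as ℤ using (+_; +[1+_])
  import Data.Integer.Properties as ℤ
  open import Data.Integer.Tactic.RingSolver using (solve-∀)
  open import Data.Rational using (mkℚ; toℚᵘ; _+_; _*_; _-_; _/_; ∣_∣; _≤_; 0ℚ; Positive; nonNegative)
  open import Data.Rational.Properties
  open import Data.Rational.Solver using (module +-*-Solver)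
  open import Data.Sum using (inj₁; inj₂)
  open import Data.Rational.Unnormalised as ℚᵘ using (mkℚᵘ; *≤*; *≡*) renaming (_≃_ to _≃ᵘ_)
  import Data.Rational.Unnormalised.Properties as ℚᵘ
  open import Data.Nat.Coprimality using (Coprime)
  open import Algebra.Bundles using (CommutativeMonoid)
  import Algebra.Properties.CommutativeSemigroup (CommutativeMonoid.commutativeSemigroup *-1-commutativeMonoid) as *-CS
  open import Relation.Binary.PropositionalEquality

  toℚᵘ-/ : ∀ i n .{{_ : NonZero n}} → toℚᵘ (i / n) ≃ᵘ mkℚᵘ i (ℕ.pred n)
  toℚᵘ-/ i (suc d) = toℚᵘ-fromℚᵘ (mkℚᵘ i d)

  toℚᵘ-fromℕ : ∀ n → toℚᵘ (fromℕ n) ≃ᵘ mkℚᵘ (+ n) 0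
  toℚᵘ-fromℕ n = toℚᵘ-/ (+ n) 1

  fromℕ-+ : ∀ m n → fromℕ (m ℕ.+ n) ≡ fromℕ m + fromℕ n
  fromℕ-+ m n = toℚᵘ-injective (ℚᵘ.≃-trans (toℚᵘ-fromℕ (m ℕ.+ n)) (ℚᵘ.≃-trans
      (*≡* (trans (cong (ℤ._* + 1) (ℤ.pos-+ m n)) (pad (+ m) (+ n))))
      (ℚᵘ.≃-sym (ℚᵘ.≃-trans (toℚᵘ-homo-+ (fromℕ m) (fromℕ n)) (ℚᵘ.+-cong (toℚᵘ-fromℕ m) (toℚᵘ-fromℕ n))))))
    where
    pad : ∀ x y → (x ℤ.+ y) ℤ.* + 1 ≡ (x ℤ.* + 1 ℤ.+ y ℤ.* + 1) ℤ.* + 1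
    pad = solve-∀

  fromℕ-* : ∀ m n → fromℕ (m ℕ.* n) ≡ fromℕ m * fromℕ n
  fromℕ-* m n = toℚᵘ-injective (ℚᵘ.≃-trans (toℚᵘ-fromℕ (m ℕ.* n)) (ℚᵘ.≃-trans
      (*≡* (cong (ℤ._* + 1) (ℤ.pos-* m n)))
      (ℚᵘ.≃-sym (ℚᵘ.≃-trans (toℚᵘ-homo-* (fromℕ m) (fromℕ n)) (ℚᵘ.*-cong (toℚᵘ-fromℕ m) (toℚᵘ-fromℕ n))))))

  fromℕ-mono-≤ : ∀ {m n} → m ℕ.≤ n → fromℕ m ≤ fromℕ n
  fromℕ-mono-≤ {m} {n} m≤n = toℚᵘ-cancel-≤ (ℚᵘ.≤-respˡ-≃ (ℚᵘ.≃-sym (toℚᵘ-fromℕ m)) (ℚᵘ.≤-respʳ-≃ (ℚᵘ.≃-sym (toℚᵘ-fromℕ n))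
    (*≤* (subst₂ ℤ._≤_ (sym (ℤ.*-identityʳ (+ m))) (sym (ℤ.*-identityʳ (+ n))) (ℤ.+≤+ m≤n)))))

  fromℕ-^ : ∀ n b → fromℕ (n ℕ.^ b) ≡ fromℕ n ^ℚ b
  fromℕ-^ n zero    = refl
  fromℕ-^ n (suc b) = trans (fromℕ-* n (n ℕ.^ b)) (cong (fromℕ n *_) (fromℕ-^ n b))

  0≤fromℕ : ∀ n → 0ℚ ≤ fromℕ n
  0≤fromℕ n = fromℕ-mono-≤ {0} {n} ℕ.z≤n

  0≤^ℚ : ∀ {x} b → 0ℚ ≤ x → 0ℚ ≤ x ^ℚ b
  0≤^ℚ     zero    0≤x = nonNegative⁻¹ _
  0≤^ℚ {x} (suc b) 0≤x = subst (_≤ x * x ^ℚ b) (*-zeroʳ x) (*-monoˡ-≤-nonNeg x ⦃ nonNegative 0≤x ⦄ (0≤^ℚ b 0≤x))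

  ^ℚ-monoˡ-≤ : ∀ {x y} b → 0ℚ ≤ x → x ≤ y → x ^ℚ b ≤ y ^ℚ b
  ^ℚ-monoˡ-≤         zero    0≤x x≤y = ≤-refl
  ^ℚ-monoˡ-≤ {x} {y} (suc b) 0≤x x≤y = ≤-trans
    (*-monoʳ-≤-nonNeg (x ^ℚ b) ⦃ nonNegative (0≤^ℚ b 0≤x) ⦄ x≤y)
    (*-monoˡ-≤-nonNeg y ⦃ nonNegative (≤-trans 0≤x x≤y) ⦄ (^ℚ-monoˡ-≤ b 0≤x x≤y))

  ^ℚ-distribʳ-* : ∀ x y b → (x * y) ^ℚ b ≡ x ^ℚ b * y ^ℚ b
  ^ℚ-distribʳ-* x y zero    = refl
  ^ℚ-distribʳ-* x y (suc b) = trans (cong ((x * y) *_) (^ℚ-distribʳ-* x y b)) (*-CS.interchange x y _ _)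

  ∣m⊖n∣≡∣m-n∣ : ∀ m n → ℤ.∣ m ℤ.⊖ n ∣ ≡ ℕ.∣ m - n ∣
  ∣m⊖n∣≡∣m-n∣ m n with ℕ.≤-total m n
  ... | inj₁ m≤n = trans (ℤ.∣⊖∣-≤ m≤n) (sym (ℕ.m≤n⇒∣m-n∣≡n∸m m≤n))
  ... | inj₂ n≤m = trans (ℤ.∣m⊖n∣≡∣n⊖m∣ m n) (trans (ℤ.∣⊖∣-≤ n≤m) (sym (ℕ.m≤n⇒∣n-m∣≡n∸m n≤m)))

  ∣cross-difference∣ : ∀ u₁ u₂ m₁ m₂ →
    ℤ.∣ + u₁ ℤ.* + m₂ ℤ.+ (ℤ.- (+ u₂)) ℤ.* + m₁ ∣ ≡ ℕ.∣ u₁ ℕ.* m₂ - u₂ ℕ.* m₁ ∣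
  ∣cross-difference∣ u₁ u₂ m₁ m₂ = begin
    ℤ.∣ + u₁ ℤ.* + m₂ ℤ.+ (ℤ.- (+ u₂)) ℤ.* + m₁ ∣
      ≡⟨ cong ℤ.∣_∣ (cong₂ ℤ._+_ (sym (ℤ.pos-* u₁ m₂))
           (trans (sym (ℤ.neg-distribˡ-* (+ u₂) (+ m₁))) (cong ℤ.-_ (sym (ℤ.pos-* u₂ m₁))))) ⟩
    ℤ.∣ + (u₁ ℕ.* m₂) ℤ.+ ℤ.- (+ (u₂ ℕ.* m₁)) ∣
      ≡⟨ cong ℤ.∣_∣ (ℤ.m-n≡m⊖n (u₁ ℕ.* m₂) (u₂ ℕ.* m₁)) ⟩
    ℤ.∣ (u₁ ℕ.* m₂) ℤ.⊖ (u₂ ℕ.* m₁) ∣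
      ≡⟨ ∣m⊖n∣≡∣m-n∣ (u₁ ℕ.* m₂) (u₂ ℕ.* m₁) ⟩
    ℕ.∣ u₁ ℕ.* m₂ - u₂ ℕ.* m₁ ∣ ∎
    where open ≡-Reasoning

  cross-multiplyᵘ : ∀ u₁ u₂ d₁ d₂ p q →
    ℚᵘ.∣ mkℚᵘ (+ u₁) d₁ ℚᵘ.- mkℚᵘ (+ u₂) d₂ ∣ ℚᵘ.≤ mkℚᵘ +[1+ q ] p →
    ℕ.∣ u₁ ℕ.* suc d₂ - u₂ ℕ.* suc d₁ ∣ ℕ.* suc p ℕ.≤ suc q ℕ.* (suc d₁ ℕ.* suc d₂)
  cross-multiplyᵘ u₁ u₂ d₁ d₂ p q (*≤* H) = ℤ.drop‿+≤+ (subst₂ ℤ._≤_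
    (trans (cong (λ n → + n ℤ.* + suc p) (∣cross-difference∣ u₁ u₂ (suc d₁) (suc d₂)))
           (sym (ℤ.pos-* ℕ.∣ u₁ ℕ.* suc d₂ - u₂ ℕ.* suc d₁ ∣ (suc p))))
    (sym (ℤ.pos-* (suc q) (suc d₁ ℕ.* suc d₂))) H)

  cross-multiply : ∀ u₁ u₂ m₁ m₂ p q .{{_ : NonZero m₁}} .{{_ : NonZero m₂}} .(c : Coprime (suc p) (suc q)) →
    ∣ + u₁ / m₁ - + u₂ / m₂ ∣ ≤ inv (mkℚ +[1+ p ] q c) →
    ℕ.∣ u₁ ℕ.* m₂ - u₂ ℕ.* m₁ ∣ ℕ.* suc p ℕ.≤ suc q ℕ.* (m₁ ℕ.* m₂)
  cross-multiply u₁ u₂ m₁@(suc d₁) m₂@(suc d₂) p q c H =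
    cross-multiplyᵘ u₁ u₂ d₁ d₂ p q (ℚᵘ.≤-respˡ-≃ toℚᵘ-difference (toℚᵘ-mono-≤ H))
    where
    x = + u₁ / m₁
    y = + u₂ / m₂
    toℚᵘ-difference : toℚᵘ ∣ x - y ∣ ≃ᵘ ℚᵘ.∣ mkℚᵘ (+ u₁) d₁ ℚᵘ.- mkℚᵘ (+ u₂) d₂ ∣
    toℚᵘ-difference = ℚᵘ.≃-trans (toℚᵘ-homo-∣-∣ (x - y)) (ℚᵘ.∣-∣-cong
      (ℚᵘ.≃-trans (toℚᵘ-homo-+ x (Data.Rational.- y))
        (ℚᵘ.+-cong (toℚᵘ-/ (+ u₁) m₁) (ℚᵘ.≃-trans (toℚᵘ-homo‿- y) (ℚᵘ.-‿cong (toℚᵘ-/ (+ u₂) m₂))))))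

  fromℕ-*-inv : ∀ p q .(c : Coprime (suc p) (suc q)) → fromℕ (suc p) * inv (mkℚ +[1+ p ] q c) ≡ fromℕ (suc q)
  fromℕ-*-inv p q c = toℚᵘ-injective (ℚᵘ.≃-trans (toℚᵘ-homo-* (fromℕ (suc p)) (inv (mkℚ +[1+ p ] q c)))
     (ℚᵘ.≃-trans (ℚᵘ.*-congʳ (toℚᵘ-fromℕ (suc p))) (ℚᵘ.≃-trans (*≡* cross) (ℚᵘ.≃-sym (toℚᵘ-fromℕ (suc q))))))
    where
    cross : (+ suc p ℤ.* +[1+ q ]) ℤ.* + 1 ≡ + suc q ℤ.* + (1 ℕ.* suc p)
    cross = commute (+ suc p) (+ suc q)
      where
      commute : ∀ x y → (x ℤ.* y) ℤ.* + 1 ≡ y ℤ.* (+ 1 ℤ.* x)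
      commute = solve-∀

  0≤fromℕ*inv+fromℕ : ∀ w₁ Y .{{_ : Positive Y}} w₂ → 0ℚ ≤ fromℕ w₁ * inv Y + fromℕ w₂
  0≤fromℕ*inv+fromℕ w₁ Y w₂ = nonNegative⁻¹ _ ⦃ nonNeg+nonNeg⇒nonNeg (fromℕ w₁ * inv Y)
    ⦃ nonNeg*nonNeg⇒nonNeg (fromℕ w₁) ⦃ nonNegative (0≤fromℕ w₁) ⦄ (inv Y) ⦃ pos⇒nonNeg (inv Y) ⦃ 1/pos⇒pos Y ⦄ ⦄ ⦄
    (fromℕ w₂) ⦃ nonNegative (0≤fromℕ w₂) ⦄ ⦄

  clear-denominator : ∀ x c w₁ w₂ p q .(cp : Coprime (suc p) (suc q)) →
    x ℕ.* suc p ℕ.≤ c ℕ.* (suc q ℕ.* w₁ ℕ.+ suc p ℕ.* w₂) →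
    fromℕ x ≤ fromℕ c * (fromℕ w₁ * inv (mkℚ +[1+ p ] q cp) + fromℕ w₂)
  clear-denominator x c w₁ w₂ p q cp H = *-cancelˡ-≤-pos (fromℕ (suc p)) ⦃ normalize-pos (suc p) 1 ⦄ (begin
    fromℕ (suc p) * fromℕ x                                ≡⟨ sym (fromℕ-* (suc p) x) ⟩
    fromℕ (suc p ℕ.* x)                                    ≤⟨ fromℕ-mono-≤ (ℕ.≤-trans (ℕ.≤-reflexive (ℕ.*-comm (suc p) x)) H) ⟩
    fromℕ (c ℕ.* (suc q ℕ.* w₁ ℕ.+ suc p ℕ.* w₂))          ≡⟨ trans (fromℕ-* c _) (cong (fromℕ c *_)
                                                               (trans (fromℕ-+ (suc q ℕ.* w₁) (suc p ℕ.* w₂))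
                                                                 (cong₂ _+_ (fromℕ-* (suc q) w₁) (fromℕ-* (suc p) w₂)))) ⟩
    C * (fromℕ (suc q) * W₁ + P * W₂)                      ≡⟨ cong (λ z → C * (z * W₁ + P * W₂)) (sym (fromℕ-*-inv p q cp)) ⟩
    C * ((P * Y⁻¹) * W₁ + P * W₂)                          ≡⟨ factor-P C P Y⁻¹ W₁ W₂ ⟩
    P * (C * (W₁ * Y⁻¹ + W₂))                              ∎)
    where
    open ≤-Reasoning
    open +-*-Solver
    C = fromℕ c
    P = fromℕ (suc p)
    W₁ = fromℕ w₁
    W₂ = fromℕ w₂
    Y⁻¹ = inv (mkℚ +[1+ p ] q cp)
    factor-P : ∀ c p i w₁ w₂ → c * ((p * i) * w₁ + p * w₂) ≡ p * (c * (w₁ * i + w₂))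
    factor-P = solve 5 (λ c p i w₁ w₂ → c :* ((p :* i) :* w₁ :+ p :* w₂) := p :* (c :* (w₁ :* i :+ w₂))) refl

  power-absorbs-factor : ∀ {x V} L R M b → 0ℚ ≤ x → 0ℚ ≤ V →
    x ≤ fromℕ (L ℕ.* R) * V → L ℕ.^ b ℕ.≤ R ℕ.^ b ℕ.* M →
    x ^ℚ b ≤ (fromℕ (R ℕ.* R) * V) ^ℚ b * fromℕ M
  power-absorbs-factor {x} {V} L R M b 0≤x 0≤V x≤LRV L^b≤R^bM = begin
    x ^ℚ b                                   ≤⟨ ^ℚ-monoˡ-≤ b 0≤x x≤LRV ⟩
    (fromℕ (L ℕ.* R) * V) ^ℚ b               ≡⟨ split L ⟩
    fromℕ (L ℕ.^ b) * RV^b                   ≤⟨ *-monoʳ-≤-nonNeg RV^b ⦃ nonNegative 0≤RV^b ⦄ (fromℕ-mono-≤ L^b≤R^bM) ⟩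
    fromℕ (R ℕ.^ b ℕ.* M) * RV^b             ≡⟨ trans (cong (_* RV^b) (fromℕ-* (R ℕ.^ b) M)) (*-CS.xy∙z≈xz∙y (fromℕ (R ℕ.^ b)) (fromℕ M) RV^b) ⟩
    fromℕ (R ℕ.^ b) * RV^b * fromℕ M         ≡⟨ cong (_* fromℕ M) (sym (split R)) ⟩
    (fromℕ (R ℕ.* R) * V) ^ℚ b * fromℕ M     ∎
    where
    open ≤-Reasoning
    RV^b = (fromℕ R * V) ^ℚ b
    0≤RV^b : 0ℚ ≤ RV^b
    0≤RV^b = 0≤^ℚ b (nonNegative⁻¹ _ ⦃ nonNeg*nonNeg⇒nonNeg (fromℕ R) ⦃ nonNegative (0≤fromℕ R) ⦄ V ⦃ nonNegative 0≤V ⦄ ⦄)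
    split : ∀ K → (fromℕ (K ℕ.* R) * V) ^ℚ b ≡ fromℕ (K ℕ.^ b) * RV^b
    split K = begin-equality
      (fromℕ (K ℕ.* R) * V) ^ℚ b     ≡⟨ cong (_^ℚ b) (trans (cong (_* V) (fromℕ-* K R)) (*-assoc (fromℕ K) (fromℕ R) V)) ⟩
      (fromℕ K * (fromℕ R * V)) ^ℚ b ≡⟨ ^ℚ-distribʳ-* (fromℕ K) (fromℕ R * V) b ⟩
      fromℕ K ^ℚ b * RV^b            ≡⟨ cong (_* RV^b) (sym (fromℕ-^ K b)) ⟩
      fromℕ (K ℕ.^ b) * RV^b         ∎

module Estimate where
  open import Data.Nat
  open import Data.Nat.Properties
  open import Data.Nat.DivMod using (_/_; m/n*n≡m)
  open import Data.Nat.Divisibility using (∣-trans; ∣1⇒≡1)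
  open import Data.Nat.Coprimality as Coprimality using (Coprime; coprime-divisor; coprime-/gcd)
  open import Data.Nat.GCD using (gcd; gcd[m,n]∣m; gcd[m,n]∣n; gcd[m,n]≤n; gcd-comm; gcd[m,n]≢0; m/gcd[m,n]≢0)
  open import Data.Nat.Tactic.RingSolver using (solve-∀)
  open import Data.Integer using (+[1+_])
  open import Function using (_∘_)
  open import Data.Rational as ℚ using (mkℚ)
  import Data.Rational.Properties as ℚ
  open import Data.List using (map; applyUpTo)
  open import Data.Nat.ListAction using (sum)
  open import Data.Product using (_,_; _×_)
  open import Data.Sum using (inj₁)
  open import Relation.Binary.PropositionalEquality
  open Counting
  open Rationals using (cross-multiply)

  Σ-range1 : ∀ n (f : ℕ → ℕ) → Σ[ range1 n ] f ≡ ∑[ i < n ] f (suc i)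
  Σ-range1 n f = go n (λ i → i)
    where
    go : ∀ n (g : ℕ → ℕ) → sum (map f (map suc (applyUpTo g n))) ≡ ∑[ i < n ] f (suc (g i))
    go zero    g = refl
    go (suc n) g = cong (f (suc (g 0)) +_) (go n (g ∘ suc))

  coprime-*ˡ : ∀ {a b c} → Coprime a c → Coprime b c → Coprime (a * b) c
  coprime-*ˡ {a} {b} {c} a⊥c b⊥c {d} (d∣ab , d∣c) = b⊥c (coprime-divisor d⊥a d∣ab , d∣c)
    where
    d⊥a : Coprime d a
    d⊥a (e∣d , e∣a) = a⊥c (e∣a , ∣-trans e∣d d∣c)

  coprime-^ˡ : ∀ {a c} k → Coprime a c → Coprime (a ^ k) c
  coprime-^ˡ zero    a⊥c (d∣1 , _) = ∣1⇒≡1 d∣1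
  coprime-^ˡ (suc k) a⊥c = coprime-*ˡ a⊥c (coprime-^ˡ k a⊥c)

  coprime-^ : ∀ {a c} k → Coprime a c → Coprime (a ^ k) (c ^ k)
  coprime-^ k a⊥c = Coprimality.sym (coprime-^ˡ k (Coprimality.sym (coprime-^ˡ k a⊥c)))

  ^-distribʳ-* : ∀ m n k → (m * n) ^ k ≡ m ^ k * n ^ k
  ^-distribʳ-* m n zero    = refl
  ^-distribʳ-* m n (suc k) = trans (cong (m * n *_) (^-distribʳ-* m n k)) (interchange m n (m ^ k) (n ^ k))
    where
    interchange : ∀ a b c d → a * b * (c * d) ≡ a * c * (b * d)
    interchange = solve-∀

  -- mkℚ +[1+ p ] q c is Y = (p+1)/(q+1), so inv Y = (q+1)/(p+1).
  module PairCount (k : ℕ) {p q : ℕ} .(c : Coprime (suc p) (suc q)) where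

    close : ℕ → ℕ → ℕ → ℕ → ℕ
    close n₁ n₂ u₁ u₂ = 𝟙 (ℚ.∣ frac k u₁ n₁ ℚ.- frac k u₂ n₂ ∣ ℚ.≤? inv (mkℚ +[1+ p ] q c))

    pair-count : ∀ n₁ n₂ .{{_ : NonZero n₁}} .{{_ : NonZero n₂}} →
      (∑[ i < n₁ ^ k ] ∑[ j < n₂ ^ k ] close n₁ n₂ (suc i) (suc j)) * suc p
        ≤ 2 * (suc q * (n₁ ^ k * n₂ ^ k)) + gcd n₁ n₂ ^ k * suc p
    pair-count n₁@(suc _) n₂@(suc _) = subst₂
      (λ M₁ M₂ → (∑[ i < M₁ ] ∑[ j < M₂ ] P i j) * suc p ≤ 2 * (suc q * (M₁ * M₂)) + g * suc p)
      (sym n₁^k≡gA) (sym n₂^k≡gB) (band-count g A B (suc p) (suc q) (coprime-^ k (coprime-/gcd n₁ n₂)) P P-close)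
      where
      d = gcd n₁ n₂
      instance
        d≢0 : NonZero d
        d≢0 = ≢-nonZero (gcd[m,n]≢0 n₁ n₂ (inj₁ (λ ())))
        x≢0 : NonZero (n₁ / d)
        x≢0 = ≢-nonZero (m/gcd[m,n]≢0 n₁ n₂)
        n₁^k≢0 : NonZero (n₁ ^ k)
        n₁^k≢0 = m^n≢0 n₁ k
        n₂^k≢0 : NonZero (n₂ ^ k)
        n₂^k≢0 = m^n≢0 n₂ k
        g≢0 : NonZero (d ^ k)
        g≢0 = m^n≢0 d k
        A≢0 : NonZero ((n₁ / d) ^ k)
        A≢0 = m^n≢0 (n₁ / d) k
      g = d ^ k
      A = (n₁ / d) ^ k
      B = (n₂ / d) ^ k
      n₁^k≡gA : n₁ ^ k ≡ g * A
      n₁^k≡gA = trans (cong (_^ k) (sym (m/n*n≡m (gcd[m,n]∣m n₁ n₂))))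
                      (trans (^-distribʳ-* (n₁ / d) d k) (*-comm A g))
      n₂^k≡gB : n₂ ^ k ≡ g * B
      n₂^k≡gB = trans (cong (_^ k) (sym (m/n*n≡m (gcd[m,n]∣n n₁ n₂))))
                      (trans (^-distribʳ-* (n₂ / d) d k) (*-comm B g))
      P : ℕ → ℕ → ℕ
      P i j = close n₁ n₂ (suc i) (suc j)
      P-close : ∀ i j → i < g * A → j < g * B → P i j ≤ 1 ×
        (1 ≤ P i j → ∣ suc i * (g * B) - suc j * (g * A) ∣ * suc p ≤ suc q * ((g * A) * (g * B)))
      P-close i j _ _ = 𝟙≤1 (ℚ.∣ u₁/m₁ ℚ.- u₂/m₂ ∣ ℚ.≤? inv (mkℚ +[1+ p ] q c)) , λ P-pos →
        subst₂ (λ M₁ M₂ → ∣ suc i * M₂ - suc j * M₁ ∣ * suc p ≤ suc q * (M₁ * M₂)) n₁^k≡gA n₂^k≡gB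
          (cross-multiply (suc i) (suc j) (n₁ ^ k) (n₂ ^ k) p q c
            (𝟙-sound (ℚ.∣ u₁/m₁ ℚ.- u₂/m₂ ∣ ℚ.≤? inv (mkℚ +[1+ p ] q c)) P-pos))
        where
        u₁/m₁ = frac k (suc i) n₁
        u₂/m₂ = frac k (suc j) n₂

    I-as-∑ : ∀ N → I k N (mkℚ +[1+ p ] q c)
                   ≡ ∑[ a₁ < N ] ∑[ a₂ < N ] ∑[ i < suc a₁ ^ k ] ∑[ j < suc a₂ ^ k ] close (suc a₁) (suc a₂) (suc i) (suc j)
    I-as-∑ N = trans (Σ-range1 N _) (∑-cong N λ a₁ _ → trans (Σ-range1 N _) (∑-cong N λ a₂ _ →
                 trans (Σ-range1 (suc a₁ ^ k) _) (∑-cong (suc a₁ ^ k) λ i _ → Σ-range1 (suc a₂ ^ k) _)))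

  m^[2n+2]≡m^n*m^n*m*m : ∀ N k → N ^ (2 * k + 2) ≡ N ^ k * N ^ k * N * N
  m^[2n+2]≡m^n*m^n*m*m N k = begin
    N ^ (2 * k + 2)                    ≡⟨ cong (N ^_) (split k) ⟩
    N ^ (k + (k + 2))                  ≡⟨ ^-distribˡ-+-* N k (k + 2) ⟩
    N ^ k * N ^ (k + 2)                ≡⟨ cong (N ^ k *_) (^-distribˡ-+-* N k 2) ⟩
    N ^ k * (N ^ k * (N * (N * 1)))    ≡⟨ reassoc (N ^ k) N ⟩
    N ^ k * N ^ k * N * N              ∎
    where
    open ≡-Reasoning
    split : ∀ k → 2 * k + 2 ≡ k + (k + 2)
    split = solve-∀
    reassoc : ∀ K N → K * (K * (N * (N * 1))) ≡ K * K * N * N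
    reassoc = solve-∀

  I-bound : ∀ k .{{_ : NonZero k}} {p q} .(c : Coprime (suc p) (suc q)) N →
    I k N (mkℚ +[1+ p ] q c) * suc p ≤ 2 * (suc q * N ^ (2 * k + 2)) + suc p * (N ^ k * divisor-sum N)
  I-bound k@(suc k′) {p} {q} c N = begin
    I k N Y * suc p
      ≡⟨ cong (_* suc p) (I-as-∑ N) ⟩
    (∑[ a₁ < N ] ∑[ a₂ < N ] cell a₁ a₂) * suc p
      ≡⟨ sym (trans (∑-cong N (λ a₁ _ → ∑-distribʳ-* N (suc p) (cell a₁))) (∑-distribʳ-* N (suc p) _)) ⟩
    ∑[ a₁ < N ] ∑[ a₂ < N ] cell a₁ a₂ * suc p
      ≤⟨ ∑-mono-≤ N (λ a₁ a₁<N → ∑-mono-≤ N (λ a₂ a₂<N → cell-bound a₁ a₂ a₁<N a₂<N)) ⟩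
    ∑[ a₁ < N ] ∑[ a₂ < N ] (T + N ^ k′ * suc p * gcd (suc a₁) (suc a₂))
      ≡⟨ ∑-cong N (λ a₁ _ → trans (∑-distrib-+ N (λ _ → T) _)
           (cong₂ _+_ (∑-const N T) (∑-distribˡ-* N (N ^ k′ * suc p) _))) ⟩
    ∑[ a₁ < N ] (N * T + N ^ k′ * suc p * (∑[ a₂ < N ] gcd (suc a₁) (suc a₂)))
      ≡⟨ trans (∑-distrib-+ N (λ _ → N * T) _) (cong₂ _+_ (∑-const N (N * T)) (∑-distribˡ-* N (N ^ k′ * suc p) _)) ⟩
    N * (N * T) + N ^ k′ * suc p * (∑[ a₁ < N ] ∑[ a₂ < N ] gcd (suc a₁) (suc a₂))
      ≤⟨ +-monoʳ-≤ (N * (N * T)) (*-monoʳ-≤ (N ^ k′ * suc p) (∑∑gcd≤ N)) ⟩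
    N * (N * T) + N ^ k′ * suc p * (N * divisor-sum N)
      ≡⟨ cong₂ _+_ (trans (regroup₁ N (N ^ k) (suc q)) (cong (λ x → 2 * (suc q * x)) (sym (m^[2n+2]≡m^n*m^n*m*m N k))))
                   (regroup₂ (N ^ k′) (suc p) N (divisor-sum N)) ⟩
    2 * (suc q * N ^ (2 * k + 2)) + suc p * (N ^ k * divisor-sum N) ∎
    where
    open ≤-Reasoning
    open PairCount k c
    Y = mkℚ +[1+ p ] q c
    T = 2 * (suc q * (N ^ k * N ^ k))
    cell : ℕ → ℕ → ℕ
    cell a₁ a₂ = ∑[ i < suc a₁ ^ k ] ∑[ j < suc a₂ ^ k ] close (suc a₁) (suc a₂) (suc i) (suc j)
    cell-bound : ∀ a₁ a₂ → a₁ < N → a₂ < N → cell a₁ a₂ * suc p ≤ T + N ^ k′ * suc p * gcd (suc a₁) (suc a₂)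
    cell-bound a₁ a₂ a₁<N a₂<N = ≤-trans (pair-count (suc a₁) (suc a₂)) (+-mono-≤
      (*-monoʳ-≤ 2 (*-monoʳ-≤ (suc q) (*-mono-≤ (^-monoˡ-≤ k a₁<N) (^-monoˡ-≤ k a₂<N))))
      (≤-trans (*-monoˡ-≤ (suc p) (*-monoʳ-≤ G (^-monoˡ-≤ k′ G≤N))) (≤-reflexive (rotate G (N ^ k′) (suc p)))))
      where
      G = gcd (suc a₁) (suc a₂)
      G≤N : G ≤ N
      G≤N = ≤-trans (subst (_≤ suc a₁) (gcd-comm (suc a₂) (suc a₁)) (gcd[m,n]≤n (suc a₂) (suc a₁))) a₁<N
      rotate : ∀ g n s → g * n * s ≡ n * s * g
      rotate = solve-∀
    regroup₁ : ∀ N K s → N * (N * (2 * (s * (K * K)))) ≡ 2 * (s * (K * K * N * N))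
    regroup₁ = solve-∀
    regroup₂ : ∀ M s N D → M * s * (N * D) ≡ s * (N * M * D)
    regroup₂ = solve-∀

  I-bound-at-scale : ∀ k .{{_ : NonZero k}} {p q} .(c : Coprime (suc p) (suc q)) R j N .{{_ : NonZero R}} →
    N ≤ R ^ suc j →
    I k N (mkℚ +[1+ p ] q c) * suc p ≤ (2 + j) * R * (suc q * N ^ (2 * k + 2) + suc p * N ^ (k + 1))
  I-bound-at-scale k {p} {q} c R j N N≤R^[1+j] = begin
    I k N (mkℚ +[1+ p ] q c) * suc p
      ≤⟨ I-bound k c N ⟩
    2 * (suc q * W₁) + suc p * (N ^ k * divisor-sum N)
      ≤⟨ +-monoʳ-≤ (2 * (suc q * W₁)) (*-monoʳ-≤ (suc p) (*-monoʳ-≤ (N ^ k) (divisor-sum≤ R N (suc j) N≤R^[1+j]))) ⟩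
    2 * (suc q * W₁) + suc p * (N ^ k * ((2 + j) * (R * N)))
      ≡⟨ cong (2 * (suc q * W₁) +_) (trans (regroup (suc p) (N ^ k) (2 + j) R N)
           (cong (λ x → (2 + j) * R * (suc p * x)) (sym (^-distribˡ-+-* N k 1)))) ⟩
    2 * (suc q * W₁) + (2 + j) * R * (suc p * W₂)
      ≤⟨ +-monoˡ-≤ _ (*-monoˡ-≤ (suc q * W₁) (≤-trans (s≤s (s≤s z≤n)) (m≤m*n (2 + j) R))) ⟩
    (2 + j) * R * (suc q * W₁) + (2 + j) * R * (suc p * W₂)
      ≡⟨ sym (*-distribˡ-+ ((2 + j) * R) (suc q * W₁) (suc p * W₂)) ⟩
    (2 + j) * R * (suc q * W₁ + suc p * W₂) ∎
    where
    open ≤-Reasoning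
    W₁ = N ^ (2 * k + 2)
    W₂ = N ^ (k + 1)
    regroup : ∀ s K L R N → s * (K * (L * (R * N))) ≡ L * R * (s * (K * (N * 1)))
    regroup = solve-∀

open import Data.Nat as ℕ using (ℕ; _^_; NonZero)
open import Data.Nat.Properties using (m^n≢0)
open import Data.Integer using (+[1+_])
open import Data.Rational using (ℚ; _≤_; _+_; _*_; Positive; mkℚ)
open import Data.Product using (∃; _,_)
open Counting using (between-powers; 1<2^n; log-factor)
open Rationals using (0≤fromℕ; 0≤fromℕ*inv+fromℕ; clear-denominator; power-absorbs-factor)
open Estimate using (I-bound-at-scale)

I-power-bound : ∀ k a b .{{_ : NonZero k}} .{{_ : NonZero a}} .{{_ : NonZero b}} N .{{_ : NonZero N}} Y .{{_ : Positive Y}} →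
  fromℕ (I k N Y) ^ℚ b
    ≤ (fromℕ (2 ^ b ℕ.* 2 ^ b) * (fromℕ (N ^ (2 ℕ.* k ℕ.+ 2)) * inv Y + fromℕ (N ^ (k ℕ.+ 1)))) ^ℚ b * fromℕ (N ^ a)
I-power-bound k a b N Y@(mkℚ +[1+ p ] q c) with j , R^j≤N , N≤R^[1+j] ← between-powers (1<2^n b) N =
  power-absorbs-factor (2 ℕ.+ j) R (N ^ a) b (0≤fromℕ (I k N Y)) (0≤fromℕ*inv+fromℕ W₁ Y W₂)
    (clear-denominator (I k N Y) ((2 ℕ.+ j) ℕ.* R) W₁ W₂ p q c (I-bound-at-scale k c R j N N≤R^[1+j]))
    (log-factor a b j N R^j≤N)
  where
  R = 2 ^ b
  instance
    R≢0 : NonZero R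
    R≢0 = m^n≢0 2 b
  W₁ = N ^ (2 ℕ.* k ℕ.+ 2)
  W₂ = N ^ (k ℕ.+ 1)

theorem2p1 : (k : ℕ) → .⦃ _ : NonZero k ⦄ → (a b : ℕ) → .⦃ _ : NonZero a ⦄ → .⦃ _ : NonZero b ⦄ →
    ∃ λ (C : ℕ) → (N : ℕ) → .⦃ _ : NonZero N ⦄ → (Y : ℚ) → .⦃ _ : Positive Y ⦄ →
      (fromℕ (I k N Y)) ^ℚ b
        ≤ ((fromℕ C * (fromℕ (N ^ (2 ℕ.* k ℕ.+ 2)) * inv Y + fromℕ (N ^ (k ℕ.+ 1)))) ^ℚ b) * fromℕ (N ^ a)
theorem2p1 k a b = 2 ^ b ℕ.* 2 ^ b , I-power-bound k a b
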